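{- Let $P:\mathcal{C}^{op}\to\mathbf{InfSL}$ be a tripos. For every object $A$ of $\mathcal{C}$ and every $\rho\in P(A\times A)$ there is a $P$-equivalence relation $\overline{\rho}$ on $A$ with $\rho\le\overline{\rho}$ such that for every $P$-equivalence relation $\sigma$ on $A$, if $\rho\le\sigma$ then $\overline{\rho}\le\sigma$.
   Context: A primary doctrine is a functor $P:\mathcal{C}^{op}\to\mathbf{InfSL}$, $\mathcal{C}$ with finite products, $\mathbf{InfSL}$ the category of inf-semilattices and meet-preserving maps; $P_f=P(f)$. $P$ is elementary if for each $A$ there is $\delta_A\in P(A\times A)$ such that for every $X$ the map $\alpha\mapsto P_{\langle pr_1,pr_2\rangle}(\alpha)\wedge P_{\langle pr_2,pr_3\rangle}(\delta_A)$, $P(X\times A)\to P(X\times A\times A)$, is left adjoint to $P_{\langle pr_1,pr_2,pr_2\rangle}$. $P$ is existential if each $P_{pr}$ along a product projection has a left adjoint satisfying Beck–Chevalley and Frobenius reciprocity. A first order doctrine is an existential elementary doctrine that is implicational (each $\alpha\wedge-$ has a right adjoint), disjunctive (finite distributive joins preserved by reindexing) and universal (right adjoints to $P_{pr}$ satisfying Beck–Chevalley). $P$ has weak power objects if for every $A$ there are an object $\mathcal{P}A$ and $\in_A\in P(A\times\mathcal{P}A)$ such that for every $Y$ and $\phi\in P(A\times Y)$ there is a (not necessarily unique) $\chi:Y\to\mathcal{P}A$ with $P_{id_A\times\chi}(\in_A)=\phi$. A tripos is a first order doctrine with weak power objects. A $P$-equivalence relation on $A$ is $\rho\in P(A\times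 A)$ with $\delta_A\le\rho$, $\rho=P_{\langle pr_2,pr_1\rangle}(\rho)$ and $P_{\langle pr_1,pr_2\rangle}(\rho)\wedge P_{\langle pr_2,pr_3\rangle}(\rho)\le P_{\langle pr_1,pr_3\rangle}(\rho)$. -}

module Defs where

open import Level using (Level; _⊔_) renaming (suc to lsuc)
open import Relation.Binary.PropositionalEquality using (_≡_)
open import Relation.Binary.Lattice.Bundles using (BoundedMeetSemilattice)
open import Data.Product using (Σ; _×_; _,_)

record Category (o h : Level) : Set (lsuc (o ⊔ h)) where
  infixr 9 _∘_
  field
    Obj  : Set o
    Hom  : Obj → Obj → Set h
    id   : ∀ {A} → Hom A A
    _∘_  : ∀ {A B C} → Hom B C → Hom A B → Hom A C
    identityˡ : ∀ {A B} (f : Hom A B) → id ∘ f ≡ f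
    identityʳ : ∀ {A B} (f : Hom A B) → f ∘ id ≡ f
    assoc     : ∀ {A B C D} (f : Hom A B) (g : Hom B C) (k : Hom C D) →
                (k ∘ g) ∘ f ≡ k ∘ (g ∘ f)

record CartesianCategory (o h : Level) : Set (lsuc (o ⊔ h)) where
  field
    category : Category o h
  open Category category public
  infixr 7 _⊗_
  field
    𝟙      : Obj
    !      : ∀ {A} → Hom A 𝟙
    !-uniq : ∀ {A} (f : Hom A 𝟙) → f ≡ !
    _⊗_    : Obj → Obj → Obj
    π₁     : ∀ {A B} → Hom (A ⊗ B) A
    π₂     : ∀ {A B} → Hom (A ⊗ B) B
    ⟨_,_⟩  : ∀ {X A B} → Hom X A → Hom X B → Hom X (A ⊗ B)
    π₁-β   : ∀ {X A B} (f : Hom X A) (g : Hom X B) → π₁ ∘ ⟨ f , g ⟩ ≡ f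
    π₂-β   : ∀ {X A B} (f : Hom X A) (g : Hom X B) → π₂ ∘ ⟨ f , g ⟩ ≡ g
    ⟨⟩-uniq : ∀ {X A B} (f : Hom X A) (g : Hom X B) (k : Hom X (A ⊗ B)) →
              π₁ ∘ k ≡ f → π₂ ∘ k ≡ g → k ≡ ⟨ f , g ⟩

  _⊗₁_ : ∀ {A B C D} → Hom A C → Hom B D → Hom (A ⊗ B) (C ⊗ D)
  f ⊗₁ g = ⟨ f ∘ π₁ , g ∘ π₂ ⟩

record PrimaryDoctrine {o h : Level} (C : CartesianCategory o h)
                       (c ℓ₁ ℓ₂ : Level) : Set (lsuc (o ⊔ h ⊔ c ⊔ ℓ₁ ⊔ ℓ₂)) where
  open CartesianCategory C
  field
    P   : Obj → BoundedMeetSemilattice c ℓ₁ ℓ₂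
  module F (A : Obj) = BoundedMeetSemilattice (P A)
  Fib : Obj → Set c
  Fib A = F.Carrier A
  field
    reindex    : ∀ {A B} → Hom A B → Fib B → Fib A
    reindex-cong : ∀ {A B} (f : Hom A B) {x y : Fib B} →
                   F._≈_ B x y → F._≈_ A (reindex f x) (reindex f y)
    reindex-∧  : ∀ {A B} (f : Hom A B) (x y : Fib B) →
                 F._≈_ A (reindex f (F._∧_ B x y)) (F._∧_ A (reindex f x) (reindex f y))
    reindex-⊤  : ∀ {A B} (f : Hom A B) → F._≈_ A (reindex f (F.⊤ B)) (F.⊤ A)
    reindex-id : ∀ {A} (x : Fib A) → F._≈_ A (reindex id x) x
    reindex-∘  : ∀ {A B D} (f : Hom A B) (g : Hom B D) (x : Fib D) →
                 F._≈_ A (reindex (g ∘ f) x) (reindex f (reindex g x))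

record Tripos {o h : Level} (C : CartesianCategory o h)
              (c ℓ₁ ℓ₂ : Level) : Set (lsuc (o ⊔ h ⊔ c ⊔ ℓ₁ ⊔ ℓ₂)) where
  open CartesianCategory C
  field
    primary : PrimaryDoctrine C c ℓ₁ ℓ₂
  open PrimaryDoctrine primary public
  field
    -- elementary: X × A × A is read as (X ⊗ A) ⊗ A, with
    -- ⟨pr₁,pr₂⟩ = π₁, ⟨pr₂,pr₃⟩ = ⟨ π₂ ∘ π₁ , π₂ ⟩, ⟨pr₁,pr₂,pr₂⟩ = ⟨ id , π₂ ⟩
    δ : ∀ A → Fib (A ⊗ A)
    elem-adj→ : ∀ {X A} (α : Fib (X ⊗ A)) (β : Fib ((X ⊗ A) ⊗ A)) →
                F._≤_ ((X ⊗ A) ⊗ A)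
                  (F._∧_ ((X ⊗ A) ⊗ A) (reindex π₁ α) (reindex ⟨ π₂ ∘ π₁ , π₂ ⟩ (δ A))) β →
                F._≤_ (X ⊗ A) α (reindex ⟨ id , π₂ ⟩ β)
    elem-adj← : ∀ {X A} (α : Fib (X ⊗ A)) (β : Fib ((X ⊗ A) ⊗ A)) →
                F._≤_ (X ⊗ A) α (reindex ⟨ id , π₂ ⟩ β) →
                F._≤_ ((X ⊗ A) ⊗ A)
                  (F._∧_ ((X ⊗ A) ⊗ A) (reindex π₁ α) (reindex ⟨ π₂ ∘ π₁ , π₂ ⟩ (δ A))) β

    ∃' : ∀ {A B} → Fib (A ⊗ B) → Fib A
    ∃-adj→ : ∀ {A B} (β : Fib (A ⊗ B)) (α : Fib A) →
             F._≤_ A (∃' β) α → F._≤_ (A ⊗ B) β (reindex π₁ α)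
    ∃-adj← : ∀ {A B} (β : Fib (A ⊗ B)) (α : Fib A) →
             F._≤_ (A ⊗ B) β (reindex π₁ α) → F._≤_ A (∃' β) α
    ∃-BC : ∀ {X A B} (f : Hom X A) (β : Fib (A ⊗ B)) →
           F._≈_ X (∃' (reindex (f ⊗₁ id) β)) (reindex f (∃' β))
    ∃-Frobenius : ∀ {A B} (α : Fib A) (β : Fib (A ⊗ B)) →
                  F._≈_ A (∃' (F._∧_ (A ⊗ B) (reindex π₁ α) β)) (F._∧_ A α (∃' β))

    _⇒_ : ∀ {A} → Fib A → Fib A → Fib A
    ⇒-adj→ : ∀ {A} (α β γ : Fib A) →
             F._≤_ A (F._∧_ A α β) γ → F._≤_ A β (α ⇒ γ)
    ⇒-adj← : ∀ {A} (α β γ : Fib A) →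
             F._≤_ A β (α ⇒ γ) → F._≤_ A (F._∧_ A α β) γ

    ⊥' : ∀ {A} → Fib A
    _∨_ : ∀ {A} → Fib A → Fib A → Fib A
    ⊥-min : ∀ {A} (α : Fib A) → F._≤_ A ⊥' α
    ∨-inl : ∀ {A} (α β : Fib A) → F._≤_ A α (α ∨ β)
    ∨-inr : ∀ {A} (α β : Fib A) → F._≤_ A β (α ∨ β)
    ∨-lub : ∀ {A} (α β γ : Fib A) →
            F._≤_ A α γ → F._≤_ A β γ → F._≤_ A (α ∨ β) γ
    ∨-distrib : ∀ {A} (α β γ : Fib A) →
                F._≤_ A (F._∧_ A α (β ∨ γ)) ((F._∧_ A α β) ∨ (F._∧_ A α γ))
    reindex-⊥ : ∀ {A B} (f : Hom A B) → F._≈_ A (reindex f ⊥') ⊥'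
    reindex-∨ : ∀ {A B} (f : Hom A B) (x y : Fib B) →
                F._≈_ A (reindex f (x ∨ y)) (reindex f x ∨ reindex f y)

    ∀' : ∀ {A B} → Fib (A ⊗ B) → Fib A
    ∀-adj→ : ∀ {A B} (α : Fib A) (β : Fib (A ⊗ B)) →
             F._≤_ (A ⊗ B) (reindex π₁ α) β → F._≤_ A α (∀' β)
    ∀-adj← : ∀ {A B} (α : Fib A) (β : Fib (A ⊗ B)) →
             F._≤_ A α (∀' β) → F._≤_ (A ⊗ B) (reindex π₁ α) β
    ∀-BC : ∀ {X A B} (f : Hom X A) (β : Fib (A ⊗ B)) →
           F._≈_ X (∀' (reindex (f ⊗₁ id) β)) (reindex f (∀' β))

    𝒫  : Obj → Obj
    ∈' : ∀ A → Fib (A ⊗ 𝒫 A)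
    weak-power : ∀ {A Y} (φ : Fib (A ⊗ Y)) →
                 Σ (Hom Y (𝒫 A)) λ χ → F._≈_ (A ⊗ Y) (reindex (id ⊗₁ χ) (∈' A)) φ

  -- P-equivalence relations; A × A × A is read as (A ⊗ A) ⊗ A, with
  -- ⟨pr₁,pr₂⟩ = π₁, ⟨pr₂,pr₃⟩ = ⟨ π₂ ∘ π₁ , π₂ ⟩, ⟨pr₁,pr₃⟩ = ⟨ π₁ ∘ π₁ , π₂ ⟩
  record IsEquivalenceRel (A : Obj) (ρ : Fib (A ⊗ A)) : Set (ℓ₁ ⊔ ℓ₂) where
    field
      refl  : F._≤_ (A ⊗ A) (δ A) ρ
      sym   : F._≈_ (A ⊗ A) ρ (reindex ⟨ π₂ , π₁ ⟩ ρ)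
      trans : F._≤_ ((A ⊗ A) ⊗ A)
                (F._∧_ ((A ⊗ A) ⊗ A) (reindex π₁ ρ) (reindex ⟨ π₂ ∘ π₁ , π₂ ⟩ ρ))
                (reindex ⟨ π₁ ∘ π₁ , π₂ ⟩ ρ)

{-# OPTIONS --safe #-}
module Submission where

-- Two points are identified by the closure of ρ when no ρ-saturated predicate tells them
-- apart:  ρ̄(a,b) = ∀U. (∀x y. ρ(x,y) ⇒ (x ∈ U ⇔ y ∈ U)) ⇒ (a ∈ U ⇔ b ∈ U).
-- The right-hand side is an equivalence in (a,b) for each fixed U, and ρ-saturation of U
-- gives ρ ≤ ρ̄.  For minimality, the weak power object provides U with y ∈ U = σ(y,a), the
-- σ-class of a; it is saturated because ρ ≤ σ and σ is an equivalence, and it contains a,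
-- so ρ̄(a,b) forces σ(b,a).  Working internally needs reindexing to preserve implication,
-- which follows from equality and existential quantification via Frobenius reciprocity.

open import Defs
open import Level using (Level)
open import Data.Product using (Σ; _×_; _,_; proj₁; proj₂)
open import Relation.Binary.PropositionalEquality as ≡ using (_≡_; cong; cong₂)

module ProductLemmas {o h : Level} (C : CartesianCategory o h) where
  open CartesianCategory C

  infixr 4 _⨾_
  _⨾_ : ∀ {A B} {f g k : Hom A B} → f ≡ g → g ≡ k → f ≡ k
  _⨾_ = ≡.trans

  ⟨⟩∘ : ∀ {X Y A B} (f : Hom Y A) (g : Hom Y B) (k : Hom X Y) → ⟨ f , g ⟩ ∘ k ≡ ⟨ f ∘ k , g ∘ k ⟩
  ⟨⟩∘ f g k = ⟨⟩-uniq (f ∘ k) (g ∘ k) (⟨ f , g ⟩ ∘ k)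
    (≡.sym (assoc k ⟨ f , g ⟩ π₁) ⨾ cong (_∘ k) (π₁-β f g))
    (≡.sym (assoc k ⟨ f , g ⟩ π₂) ⨾ cong (_∘ k) (π₂-β f g))

  g-η : ∀ {X A B} (k : Hom X (A ⊗ B)) → ⟨ π₁ ∘ k , π₂ ∘ k ⟩ ≡ k
  g-η k = ≡.sym (⟨⟩-uniq _ _ k ≡.refl ≡.refl)

  η : ∀ {A B} → ⟨ π₁ , π₂ ⟩ ≡ id {A ⊗ B}
  η = ≡.sym (⟨⟩-uniq _ _ id (identityʳ π₁) (identityʳ π₂))

  ∘π₁-⟨⟩ : ∀ {X Y A B} (p : Hom A Y) (f : Hom X A) (g : Hom X B) → (p ∘ π₁) ∘ ⟨ f , g ⟩ ≡ p ∘ f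
  ∘π₁-⟨⟩ p f g = assoc _ _ _ ⨾ cong (p ∘_) (π₁-β f g)

  ∘π₂-⟨⟩ : ∀ {X Y A B} (p : Hom B Y) (f : Hom X A) (g : Hom X B) → (p ∘ π₂) ∘ ⟨ f , g ⟩ ≡ p ∘ g
  ∘π₂-⟨⟩ p f g = assoc _ _ _ ⨾ cong (p ∘_) (π₂-β f g)

  swap-⟨⟩ : ∀ {X A B} (a : Hom X A) (b : Hom X B) → ⟨ π₂ , π₁ ⟩ ∘ ⟨ a , b ⟩ ≡ ⟨ b , a ⟩
  swap-⟨⟩ a b = ⟨⟩∘ _ _ _ ⨾ cong₂ ⟨_,_⟩ (π₂-β a b) (π₁-β a b)

  pr₂₃-⟨⟩ : ∀ {X A B D} (a : Hom X A) (b : Hom X B) (d : Hom X D) →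
            ⟨ π₂ ∘ π₁ , π₂ ⟩ ∘ ⟨ ⟨ a , b ⟩ , d ⟩ ≡ ⟨ b , d ⟩
  pr₂₃-⟨⟩ a b d = ⟨⟩∘ _ _ _ ⨾ cong₂ ⟨_,_⟩ (∘π₁-⟨⟩ π₂ _ _ ⨾ π₂-β a b) (π₂-β _ _)

  pr₁₃-⟨⟩ : ∀ {X A B D} (a : Hom X A) (b : Hom X B) (d : Hom X D) →
            ⟨ π₁ ∘ π₁ , π₂ ⟩ ∘ ⟨ ⟨ a , b ⟩ , d ⟩ ≡ ⟨ a , d ⟩
  pr₁₃-⟨⟩ a b d = ⟨⟩∘ _ _ _ ⨾ cong₂ ⟨_,_⟩ (∘π₁-⟨⟩ π₁ _ _ ⨾ π₁-β a b) (π₂-β _ _)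

  pr₂₃-⟨id,π₂⟩ : ∀ {A} → ⟨ π₂ ∘ π₁ , π₂ ⟩ ∘ ⟨ id , π₂ ⟩ ≡ ⟨ π₂ , π₂ {A} {A} ⟩
  pr₂₃-⟨id,π₂⟩ = ⟨⟩∘ _ _ _ ⨾ cong₂ ⟨_,_⟩ (∘π₁-⟨⟩ π₂ id π₂ ⨾ identityʳ π₂) (π₂-β id π₂)

module InternalLogic {o h c ℓ₁ ℓ₂ : Level} {C : CartesianCategory o h} (T : Tripos C c ℓ₁ ℓ₂) where
  open CartesianCategory C
  open Tripos T
  open ProductLemmas C

  -- Wrapping the fibres in a record makes the context Γ inferable from a formula.
  record Fm (Γ : Obj) : Set c where
    constructor [_]
    field un : Fib Γ
  open Fm public

  infix  4 _⊑_ _≋_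
  infixr 8 _∧_
  infixr 6 _⟹_
  infix  8.5 _⇔_
  infixr 9 _⋆_

  _⊑_ : ∀ {Γ} → Fm Γ → Fm Γ → Set ℓ₂
  _⊑_ {Γ} x y = F._≤_ Γ (un x) (un y)

  _≋_ : ∀ {Γ} → Fm Γ → Fm Γ → Set ℓ₁
  _≋_ {Γ} x y = F._≈_ Γ (un x) (un y)

  ⊤ : ∀ {Γ} → Fm Γ
  ⊤ {Γ} = [ F.⊤ Γ ]

  _∧_ : ∀ {Γ} → Fm Γ → Fm Γ → Fm Γ
  _∧_ {Γ} x y = [ F._∧_ Γ (un x) (un y) ]

  _⟹_ : ∀ {Γ} → Fm Γ → Fm Γ → Fm Γ
  x ⟹ y = [ un x ⇒ un y ]

  _⇔_ : ∀ {Γ} → Fm Γ → Fm Γ → Fm Γ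
  p ⇔ q = (p ⟹ q) ∧ (q ⟹ p)

  _⋆_ : ∀ {Δ Γ} → Hom Δ Γ → Fm Γ → Fm Δ
  f ⋆ x = [ reindex f (un x) ]

  ∀ᶠ : ∀ {Γ B} → Fm (Γ ⊗ B) → Fm Γ
  ∀ᶠ {Γ} {B} x = [ ∀' {Γ} {B} (un x) ]

  ∃ᶠ : ∀ {Γ B} → Fm (Γ ⊗ B) → Fm Γ
  ∃ᶠ {Γ} {B} x = [ ∃' {Γ} {B} (un x) ]

  _⟦_,_⟧ : ∀ {Δ A B} → Fm (A ⊗ B) → Hom Δ A → Hom Δ B → Fm Δ
  R ⟦ a , b ⟧ = ⟨ a , b ⟩ ⋆ R

  Eq : ∀ A → Fm (A ⊗ A)
  Eq A = [ δ A ]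

  module _ {Γ : Obj} where
    infixr 4 _⊚_ _≋⨾_

    ⊑-refl : {x : Fm Γ} → x ⊑ x
    ⊑-refl = F.refl Γ

    _⊚_ : {x y z : Fm Γ} → x ⊑ y → y ⊑ z → x ⊑ z
    p ⊚ q = F.trans Γ p q

    ⊑-antisym : {x y : Fm Γ} → x ⊑ y → y ⊑ x → x ≋ y
    ⊑-antisym = F.antisym Γ

    ≋-refl : {x : Fm Γ} → x ≋ x
    ≋-refl = F.Eq.refl Γ

    ≋-sym : {x y : Fm Γ} → x ≋ y → y ≋ x
    ≋-sym = F.Eq.sym Γ

    _≋⨾_ : {x y z : Fm Γ} → x ≋ y → y ≋ z → x ≋ z
    _≋⨾_ = F.Eq.trans Γ

    ≋⇒⊑ : {x y : Fm Γ} → x ≋ y → x ⊑ y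
    ≋⇒⊑ = F.reflexive Γ

    ≋⇒⊒ : {x y : Fm Γ} → x ≋ y → y ⊑ x
    ≋⇒⊒ e = ≋⇒⊑ (≋-sym e)

    ⊤-max : {x : Fm Γ} → x ⊑ ⊤
    ⊤-max {x} = F.maximum Γ (un x)

    ∧-l : {x y : Fm Γ} → x ∧ y ⊑ x
    ∧-l {x} {y} = F.x∧y≤x Γ (un x) (un y)

    ∧-r : {x y : Fm Γ} → x ∧ y ⊑ y
    ∧-r {x} {y} = F.x∧y≤y Γ (un x) (un y)

    ∧-greatest : {x y z : Fm Γ} → x ⊑ y → x ⊑ z → x ⊑ y ∧ z
    ∧-greatest = F.∧-greatest Γ

    ∧-mono : {x y x' y' : Fm Γ} → x ⊑ x' → y ⊑ y' → x ∧ y ⊑ x' ∧ y'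
    ∧-mono p q = ∧-greatest (∧-l ⊚ p) (∧-r ⊚ q)

    ∧-comm : {x y : Fm Γ} → x ∧ y ⊑ y ∧ x
    ∧-comm = ∧-greatest ∧-r ∧-l

    ∧-cong : {x y x' y' : Fm Γ} → x ≋ x' → y ≋ y' → x ∧ y ≋ x' ∧ y'
    ∧-cong p q = ⊑-antisym (∧-mono (≋⇒⊑ p) (≋⇒⊑ q)) (∧-mono (≋⇒⊒ p) (≋⇒⊒ q))

    ⟹-intro : {x y z : Fm Γ} → x ∧ y ⊑ z → y ⊑ x ⟹ z
    ⟹-intro {x} {y} {z} = ⇒-adj→ (un x) (un y) (un z)

    ⟹-uncurry : {x y z : Fm Γ} → y ⊑ x ⟹ z → x ∧ y ⊑ z
    ⟹-uncurry {x} {y} {z} = ⇒-adj← (un x) (un y) (un z)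

    modus-ponens : {x y z : Fm Γ} → y ⊑ x ⟹ z → y ⊑ x → y ⊑ z
    modus-ponens p q = ∧-greatest q ⊑-refl ⊚ ⟹-uncurry p

    ⟹-mono : {x y x' y' : Fm Γ} → x' ⊑ x → y ⊑ y' → x ⟹ y ⊑ x' ⟹ y'
    ⟹-mono p q = ⟹-intro (∧-mono p ⊑-refl ⊚ ⟹-uncurry ⊑-refl ⊚ q)

    ⟹-cong : {x y x' y' : Fm Γ} → x ≋ x' → y ≋ y' → x ⟹ y ≋ x' ⟹ y'
    ⟹-cong p q = ⊑-antisym (⟹-mono (≋⇒⊒ p) (≋⇒⊑ q)) (⟹-mono (≋⇒⊑ p) (≋⇒⊒ q))

    ⇔-cong : {p q p' q' : Fm Γ} → p ≋ p' → q ≋ q' → p ⇔ q ≋ p' ⇔ q'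
    ⇔-cong a b = ∧-cong (⟹-cong a b) (⟹-cong b a)

    ⇔-sym : {p q : Fm Γ} → p ⇔ q ⊑ q ⇔ p
    ⇔-sym = ∧-comm

    ⇔-trans : {p q r : Fm Γ} → p ⇔ q ∧ q ⇔ r ⊑ p ⇔ r
    ⇔-trans = ∧-greatest
      (⟹-intro (modus-ponens (∧-r ⊚ ∧-r ⊚ ∧-l) (modus-ponens (∧-r ⊚ ∧-l ⊚ ∧-l) ∧-l)))
      (⟹-intro (modus-ponens (∧-r ⊚ ∧-l ⊚ ∧-r) (modus-ponens (∧-r ⊚ ∧-r ⊚ ∧-r) ∧-l)))

  module _ {Δ Γ : Obj} (f : Hom Δ Γ) where
    ⋆-∧ : {x y : Fm Γ} → f ⋆ (x ∧ y) ≋ f ⋆ x ∧ f ⋆ y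
    ⋆-∧ {x} {y} = reindex-∧ f (un x) (un y)

    ⋆-⊤ : f ⋆ ⊤ ≋ ⊤
    ⋆-⊤ = reindex-⊤ f

    ⋆-cong : {x y : Fm Γ} → x ≋ y → f ⋆ x ≋ f ⋆ y
    ⋆-cong = reindex-cong f

    ⋆-mono : {x y : Fm Γ} → x ⊑ y → f ⋆ x ⊑ f ⋆ y
    ⋆-mono p = ≋⇒⊑ (⋆-cong (⊑-antisym (∧-greatest ⊑-refl p) ∧-l)) ⊚ ≋⇒⊑ ⋆-∧ ⊚ ∧-r

    ⋆-⟹-lax : {x y : Fm Γ} → f ⋆ (x ⟹ y) ⊑ f ⋆ x ⟹ f ⋆ y
    ⋆-⟹-lax = ⟹-intro (≋⇒⊒ ⋆-∧ ⊚ ⋆-mono (⟹-uncurry ⊑-refl))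

  ⋆-id : ∀ {Γ} {x : Fm Γ} → id ⋆ x ≋ x
  ⋆-id {x = x} = reindex-id (un x)

  ⋆-≡ : ∀ {Δ Γ} {f g : Hom Δ Γ} {x : Fm Γ} → f ≡ g → f ⋆ x ≋ g ⋆ x
  ⋆-≡ ≡.refl = ≋-refl

  ⋆-∘ : ∀ {A B D} {f : Hom A B} {g : Hom B D} {k : Hom A D} {x : Fm D} →
        g ∘ f ≡ k → f ⋆ (g ⋆ x) ≋ k ⋆ x
  ⋆-∘ {f = f} {g} {x = x} e = ≋-sym (reindex-∘ f g (un x)) ≋⨾ ⋆-≡ e

  ⟦⟧-≡ : ∀ {Δ A B} (R : Fm (A ⊗ B)) {a a' : Hom Δ A} {b b' : Hom Δ B} →
         a ≡ a' → b ≡ b' → R ⟦ a , b ⟧ ≋ R ⟦ a' , b' ⟧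
  ⟦⟧-≡ R p q = ⋆-≡ (cong₂ ⟨_,_⟩ p q)

  ⋆-⟦⟧ : ∀ {Δ' Δ A B} (k : Hom Δ' Δ) (R : Fm (A ⊗ B)) (a : Hom Δ A) (b : Hom Δ B) →
         k ⋆ R ⟦ a , b ⟧ ≋ R ⟦ a ∘ k , b ∘ k ⟧
  ⋆-⟦⟧ k R a b = ⋆-∘ (⟨⟩∘ a b k)

  ⟦π₁,π₂⟧ : ∀ {A B} (R : Fm (A ⊗ B)) → R ≋ R ⟦ π₁ , π₂ ⟧
  ⟦π₁,π₂⟧ R = ≋-sym (⋆-≡ η ≋⨾ ⋆-id)

  module _ {Γ B : Obj} where
    ∀-intro : {γ : Fm Γ} {β : Fm (Γ ⊗ B)} → π₁ ⋆ γ ⊑ β → γ ⊑ ∀ᶠ β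
    ∀-intro {γ} {β} = ∀-adj→ (un γ) (un β)

    ∀-elim : ∀ {Δ} (f : Hom Δ Γ) (e : Hom Δ B) {β : Fm (Γ ⊗ B)} → f ⋆ ∀ᶠ β ⊑ ⟨ f , e ⟩ ⋆ β
    ∀-elim f e {β} = ≋⇒⊒ (⋆-∘ (π₁-β f e)) ⊚ ⋆-mono ⟨ f , e ⟩ (∀-adj← (un (∀ᶠ β)) (un β) ⊑-refl)

    ∃-elim : {β : Fm (Γ ⊗ B)} {α : Fm Γ} → β ⊑ π₁ ⋆ α → ∃ᶠ β ⊑ α
    ∃-elim {β} {α} = ∃-adj← (un β) (un α)

    ∃-intro : ∀ {Δ} (f : Hom Δ Γ) (e : Hom Δ B) {β : Fm (Γ ⊗ B)} → ⟨ f , e ⟩ ⋆ β ⊑ f ⋆ ∃ᶠ β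
    ∃-intro f e {β} = ⋆-mono ⟨ f , e ⟩ (∃-adj→ (un β) (un (∃ᶠ β)) ⊑-refl) ⊚ ≋⇒⊑ (⋆-∘ (π₁-β f e))

    ∃-frobenius : {α : Fm Γ} {β : Fm (Γ ⊗ B)} → α ∧ ∃ᶠ β ⊑ ∃ᶠ (π₁ ⋆ α ∧ β)
    ∃-frobenius {α} {β} = ≋⇒⊒ (∃-Frobenius (un α) (un β))

  ⋆-∀ : ∀ {X A B} (f : Hom X A) {β : Fm (A ⊗ B)} → f ⋆ ∀ᶠ β ≋ ∀ᶠ ((f ⊗₁ id) ⋆ β)
  ⋆-∀ f {β} = ≋-sym (∀-BC f (un β))

  Eq-refl : ∀ {Δ A} (t : Hom Δ A) → ⊤ ⊑ Eq A ⟦ t , t ⟧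
  Eq-refl {A = A} t =
    ≋⇒⊒ (⋆-⊤ ⟨ t , t ⟩) ⊚ ⋆-mono ⟨ t , t ⟩ diagonal
      ⊚ ≋⇒⊑ (⋆-∘ (⟨⟩∘ _ _ _ ⨾ cong₂ ⟨_,_⟩ (π₂-β t t) (π₂-β t t)))
    where
      diagonal : ⊤ ⊑ ⟨ π₂ , π₂ ⟩ ⋆ Eq A
      diagonal = elem-adj→ {A} {A} (F.⊤ (A ⊗ A)) (un (⟨ π₂ ∘ π₁ , π₂ ⟩ ⋆ Eq A)) ∧-r
                 ⊚ ≋⇒⊑ (⋆-∘ pr₂₃-⟨id,π₂⟩)

  Eq-subst : ∀ {Δ A B} (φ : Fm (B ⊗ A)) (u : Hom Δ B) (t t' : Hom Δ A) →
             Eq A ⟦ t , t' ⟧ ∧ φ ⟦ u , t ⟧ ⊑ φ ⟦ u , t' ⟧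
  Eq-subst {A = A} {B} φ u t t' =
    ∧-comm ⊚ ∧-mono (≋⇒⊒ (⋆-∘ (π₁-β _ _))) (≋⇒⊒ (⋆-∘ (pr₂₃-⟨⟩ u t t'))) ⊚ ≋⇒⊒ (⋆-∧ k)
      ⊚ ⋆-mono k elementary ⊚ ≋⇒⊑ (⋆-∘ (pr₁₃-⟨⟩ u t t'))
    where
      k = ⟨ ⟨ u , t ⟩ , t' ⟩
      φ₁₃ : Fm ((B ⊗ A) ⊗ A)
      φ₁₃ = ⟨ π₁ ∘ π₁ , π₂ ⟩ ⋆ φ
      φ⊑φ₁₃-on-diagonal : φ ⊑ ⟨ id , π₂ ⟩ ⋆ φ₁₃
      φ⊑φ₁₃-on-diagonal =
        ≋⇒⊒ (⋆-∘ (⟨⟩∘ _ _ _ ⨾ cong₂ ⟨_,_⟩ (∘π₁-⟨⟩ π₁ id π₂ ⨾ identityʳ π₁) (π₂-β id π₂) ⨾ η) ≋⨾ ⋆-id)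
      elementary : π₁ ⋆ φ ∧ ⟨ π₂ ∘ π₁ , π₂ ⟩ ⋆ Eq A ⊑ φ₁₃
      elementary = elem-adj← {B} {A} (un φ) (un φ₁₃) φ⊑φ₁₃-on-diagonal

  Eq-subst₁ : ∀ {Δ A} (X : Fm A) (t t' : Hom Δ A) → Eq A ⟦ t , t' ⟧ ∧ t ⋆ X ⊑ t' ⋆ X
  Eq-subst₁ X t t' = ∧-mono ⊑-refl (≋⇒⊒ (at t)) ⊚ Eq-subst (π₂ ⋆ X) t t t' ⊚ ≋⇒⊑ (at t')
    where
      at : ∀ s → (π₂ ⋆ X) ⟦ t , s ⟧ ≋ s ⋆ X
      at s = ⋆-∘ (π₂-β t s)

  Eq-sym : ∀ {Δ A} (t t' : Hom Δ A) → Eq A ⟦ t , t' ⟧ ⊑ Eq A ⟦ t' , t ⟧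
  Eq-sym {A = A} t t' =
    ∧-greatest ⊑-refl (⊤-max ⊚ Eq-refl t ⊚ ≋⇒⊒ (swapped t t))
      ⊚ Eq-subst (⟨ π₂ , π₁ ⟩ ⋆ Eq A) t t t' ⊚ ≋⇒⊑ (swapped t t')
    where
      swapped : ∀ u s → (⟨ π₂ , π₁ ⟩ ⋆ Eq A) ⟦ u , s ⟧ ≋ Eq A ⟦ s , u ⟧
      swapped u s = ⋆-∘ (swap-⟨⟩ u s)

  -- f⋆ has the left adjoint ∃_f Z (x) = ∃y. f y = x ∧ Z y, built from Eq and ∃ᶠ; the unit
  -- Z ⊑ f⋆ ∃_f Z and Frobenius reciprocity for ∃_f give the inequality.
  ⋆-⟹-colax : ∀ {Δ Γ} (f : Hom Δ Γ) {X Y : Fm Γ} → f ⋆ X ⟹ f ⋆ Y ⊑ f ⋆ (X ⟹ Y)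
  ⋆-⟹-colax {Δ} {Γ} f {X} {Y} = Z⊑f⋆∃fZ ⊚ ⋆-mono f ∃fZ⊑X⟹Y
    where
      Z = f ⋆ X ⟹ f ⋆ Y
      fy : Hom (Γ ⊗ Δ) Γ
      fy = f ∘ π₂
      Z-on-fibre : Fm (Γ ⊗ Δ)
      Z-on-fibre = Eq Γ ⟦ fy , π₁ ⟧ ∧ π₂ ⋆ Z
      Z⊑f⋆∃fZ : Z ⊑ f ⋆ ∃ᶠ Z-on-fibre
      Z⊑f⋆∃fZ =
        ∧-greatest (⊤-max ⊚ Eq-refl f ⊚ ≋⇒⊒ (⋆-⟦⟧ _ (Eq Γ) _ _ ≋⨾ ⟦⟧-≡ (Eq Γ) fy-at-f x-at-f))
                   (≋⇒⊒ (⋆-∘ (π₂-β f id) ≋⨾ ⋆-id))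
          ⊚ ≋⇒⊒ (⋆-∧ ⟨ f , id ⟩) ⊚ ∃-intro f id
        where
          fy-at-f : fy ∘ ⟨ f , id ⟩ ≡ f
          fy-at-f = ∘π₂-⟨⟩ f f id ⨾ identityʳ f
          x-at-f : π₁ ∘ ⟨ f , id ⟩ ≡ f
          x-at-f = π₁-β f id
      H = π₁ ⋆ X ∧ Z-on-fibre
      H⊑fy⋆X : H ⊑ fy ⋆ X
      H⊑fy⋆X = ∧-greatest (∧-r ⊚ ∧-l ⊚ Eq-sym fy π₁) ∧-l ⊚ Eq-subst₁ X π₁ fy
      H⊑Z-at-y : H ⊑ fy ⋆ X ⟹ fy ⋆ Y
      H⊑Z-at-y = ∧-r ⊚ ∧-r ⊚ ⋆-⟹-lax π₂ ⊚ ⟹-mono (≋⇒⊒ (⋆-∘ ≡.refl)) (≋⇒⊑ (⋆-∘ ≡.refl))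
      ∃fZ⊑X⟹Y : ∃ᶠ Z-on-fibre ⊑ X ⟹ Y
      ∃fZ⊑X⟹Y = ⟹-intro (∃-frobenius ⊚ ∃-elim (∧-greatest (∧-r ⊚ ∧-l) (modus-ponens H⊑Z-at-y H⊑fy⋆X)
                                                 ⊚ Eq-subst₁ Y fy π₁))

  ⋆-⟹ : ∀ {Δ Γ} (f : Hom Δ Γ) {X Y : Fm Γ} → f ⋆ (X ⟹ Y) ≋ f ⋆ X ⟹ f ⋆ Y
  ⋆-⟹ f = ⊑-antisym (⋆-⟹-lax f) (⋆-⟹-colax f)

  ⋆-⇔ : ∀ {Δ Γ} (f : Hom Δ Γ) {p q : Fm Γ} → f ⋆ (p ⇔ q) ≋ f ⋆ p ⇔ f ⋆ q
  ⋆-⇔ f = ⋆-∧ f ≋⨾ ∧-cong (⋆-⟹ f) (⋆-⟹ f)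

  module EquivalenceRelations {A : Obj} where
    module OnTerms {R : Fm (A ⊗ A)} (R-eq : IsEquivalenceRel A (un R)) where
      open IsEquivalenceRel R-eq

      refl-⟦⟧ : ∀ {Δ} (t : Hom Δ A) → ⊤ ⊑ R ⟦ t , t ⟧
      refl-⟦⟧ t = Eq-refl t ⊚ ⋆-mono ⟨ t , t ⟩ refl

      sym-⟦⟧ : ∀ {Δ} (t s : Hom Δ A) → R ⟦ t , s ⟧ ⊑ R ⟦ s , t ⟧
      sym-⟦⟧ t s = ⋆-mono ⟨ t , s ⟩ (≋⇒⊑ sym) ⊚ ≋⇒⊑ (⋆-∘ (swap-⟨⟩ t s))

      trans-⟦⟧ : ∀ {Δ} (t₁ t₂ t₃ : Hom Δ A) → R ⟦ t₁ , t₂ ⟧ ∧ R ⟦ t₂ , t₃ ⟧ ⊑ R ⟦ t₁ , t₃ ⟧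
      trans-⟦⟧ t₁ t₂ t₃ =
        ∧-mono (≋⇒⊒ (⋆-∘ (π₁-β _ _))) (≋⇒⊒ (⋆-∘ (pr₂₃-⟨⟩ t₁ t₂ t₃))) ⊚ ≋⇒⊒ (⋆-∧ k)
          ⊚ ⋆-mono k trans ⊚ ≋⇒⊑ (⋆-∘ (pr₁₃-⟨⟩ t₁ t₂ t₃))
        where k = ⟨ ⟨ t₁ , t₂ ⟩ , t₃ ⟩

    isEquivalenceRel-⟦⟧ : {R : Fm (A ⊗ A)} →
      (∀ {Δ} (t s : Hom Δ A) → Eq A ⟦ t , s ⟧ ⊑ R ⟦ t , s ⟧) →
      (∀ {Δ} (t s : Hom Δ A) → R ⟦ t , s ⟧ ⊑ R ⟦ s , t ⟧) →
      (∀ {Δ} (t₁ t₂ t₃ : Hom Δ A) → R ⟦ t₁ , t₂ ⟧ ∧ R ⟦ t₂ , t₃ ⟧ ⊑ R ⟦ t₁ , t₃ ⟧) →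
      IsEquivalenceRel A (un R)
    isEquivalenceRel-⟦⟧ {R} refl-⟦⟧ sym-⟦⟧ trans-⟦⟧ = record
      { refl  = ≋⇒⊑ (⟦π₁,π₂⟧ (Eq A)) ⊚ refl-⟦⟧ π₁ π₂ ⊚ ≋⇒⊒ (⟦π₁,π₂⟧ R)
      ; sym   = ⊑-antisym (≋⇒⊑ (⟦π₁,π₂⟧ R) ⊚ sym-⟦⟧ π₁ π₂) (sym-⟦⟧ π₂ π₁ ⊚ ≋⇒⊒ (⟦π₁,π₂⟧ R))
      ; trans = ∧-mono (≋⇒⊑ (⋆-≡ (≡.sym (g-η π₁)))) ⊑-refl ⊚ trans-⟦⟧ _ _ _
      }

module EquivalenceClosure {o h c ℓ₁ ℓ₂ : Level} {C : CartesianCategory o h} (T : Tripos C c ℓ₁ ℓ₂)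
                          (A : CartesianCategory.Obj C) (ρ : Tripos.Fib T (CartesianCategory._⊗_ C A A)) where
  open CartesianCategory C
  open Tripos T using (𝒫; ∈'; weak-power; IsEquivalenceRel)
  open ProductLemmas C
  open InternalLogic T
  open EquivalenceRelations {A}

  R : Fm (A ⊗ A)
  R = [ ρ ]

  infix 8.8 _∈_
  _∈_ : ∀ {Δ} → Hom Δ A → Hom Δ (𝒫 A) → Fm Δ
  t ∈ U = [ ∈' A ] ⟦ t , U ⟧

  Saturated : Fm (𝒫 A)
  Saturated = ∀ᶠ (π₂ ⋆ R ⟹ (π₁ ∘ π₂ ∈ π₁) ⇔ (π₂ ∘ π₂ ∈ π₁))

  Agree : ∀ {Δ} → Hom Δ (𝒫 A) → Hom Δ A → Hom Δ A → Fm Δ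
  Agree U a b = U ⋆ Saturated ⟹ (a ∈ U) ⇔ (b ∈ U)

  ρ̄ : Fm (A ⊗ A)
  ρ̄ = ∀ᶠ (Agree π₂ (π₁ ∘ π₁) (π₂ ∘ π₁))

  ⋆-∈ : ∀ {Δ Δ'} (k : Hom Δ' Δ) (t : Hom Δ A) (U : Hom Δ (𝒫 A)) → k ⋆ (t ∈ U) ≋ t ∘ k ∈ U ∘ k
  ⋆-∈ k t U = ⋆-⟦⟧ k [ ∈' A ] t U

  ∈-≡ : ∀ {Δ} {t t' : Hom Δ A} {U U' : Hom Δ (𝒫 A)} → t ≡ t' → U ≡ U' → t ∈ U ≋ t' ∈ U'
  ∈-≡ = ⟦⟧-≡ [ ∈' A ]

  ⋆-Agree : ∀ {Δ Δ'} (k : Hom Δ' Δ) (U : Hom Δ (𝒫 A)) (a b : Hom Δ A) →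
            k ⋆ Agree U a b ≋ Agree (U ∘ k) (a ∘ k) (b ∘ k)
  ⋆-Agree k U a b = ⋆-⟹ k ≋⨾ ⟹-cong (⋆-∘ ≡.refl) (⋆-⇔ k ≋⨾ ⇔-cong (⋆-∈ k a U) (⋆-∈ k b U))

  Agree-≡ : ∀ {Δ} {U U' : Hom Δ (𝒫 A)} {a a' b b' : Hom Δ A} →
            U ≡ U' → a ≡ a' → b ≡ b' → Agree U a b ≋ Agree U' a' b'
  Agree-≡ ≡.refl ≡.refl ≡.refl = ≋-refl

  ρ̄-intro : ∀ {Δ} (t s : Hom Δ A) {γ : Fm Δ} → π₁ ⋆ γ ⊑ Agree π₂ (t ∘ π₁) (s ∘ π₁) → γ ⊑ ρ̄ ⟦ t , s ⟧
  ρ̄-intro t s p = ∀-intro (p ⊚ ≋⇒⊒ (⋆-Agree (⟨ t , s ⟩ ⊗₁ id) _ _ _ ≋⨾ Agree-≡ U-at a-at b-at)) ⊚ ≋⇒⊒ (⋆-∀ ⟨ t , s ⟩)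
    where
      reindexed : ∀ (q : Hom (A ⊗ A) A) {r} → q ∘ ⟨ t , s ⟩ ≡ r → (q ∘ π₁) ∘ (⟨ t , s ⟩ ⊗₁ id) ≡ r ∘ π₁
      reindexed q eq = ∘π₁-⟨⟩ q _ _ ⨾ ≡.sym (assoc π₁ ⟨ t , s ⟩ q) ⨾ cong (_∘ π₁) eq
      U-at = π₂-β _ _ ⨾ identityˡ π₂
      a-at = reindexed π₁ (π₁-β t s)
      b-at = reindexed π₂ (π₂-β t s)

  ρ̄-elim : ∀ {Δ} (t s : Hom Δ A) (U : Hom Δ (𝒫 A)) → ρ̄ ⟦ t , s ⟧ ⊑ Agree U t s
  ρ̄-elim t s U =
    ∀-elim ⟨ t , s ⟩ U
      ⊚ ≋⇒⊑ (⋆-Agree _ _ _ _ ≋⨾ Agree-≡ (π₂-β _ _) (∘π₁-⟨⟩ π₁ _ _ ⨾ π₁-β t s) (∘π₁-⟨⟩ π₂ _ _ ⨾ π₂-β t s))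

  Saturated-elim : ∀ {Δ} (U : Hom Δ (𝒫 A)) (a b : Hom Δ A) →
                   U ⋆ Saturated ⊑ R ⟦ a , b ⟧ ⟹ (a ∈ U) ⇔ (b ∈ U)
  Saturated-elim U a b = ∀-elim U ⟨ a , b ⟩ ⊚ ≋⇒⊑ (⋆-⟹ k ≋⨾ ⟹-cong (⋆-∘ (π₂-β U ⟨ a , b ⟩)) ⇔-at)
    where
      k = ⟨ U , ⟨ a , b ⟩ ⟩
      ⇔-at : k ⋆ ((π₁ ∘ π₂ ∈ π₁) ⇔ (π₂ ∘ π₂ ∈ π₁)) ≋ (a ∈ U) ⇔ (b ∈ U)
      ⇔-at = ⋆-⇔ k ≋⨾ ⇔-cong (⋆-∈ k _ _ ≋⨾ ∈-≡ (∘π₂-⟨⟩ π₁ _ _ ⨾ π₁-β a b) (π₁-β _ _))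
                             (⋆-∈ k _ _ ≋⨾ ∈-≡ (∘π₂-⟨⟩ π₂ _ _ ⨾ π₂-β a b) (π₁-β _ _))

  Saturated-intro : ∀ {Δ} (U : Hom Δ (𝒫 A)) {γ : Fm Δ} →
    π₁ ⋆ γ ∧ R ⟦ π₁ ∘ π₂ , π₂ ∘ π₂ ⟧ ⊑ (π₁ ∘ π₂ ∈ U ∘ π₁) ⇔ (π₂ ∘ π₂ ∈ U ∘ π₁) → γ ⊑ U ⋆ Saturated
  Saturated-intro U p =
    ∀-intro (⟹-intro (∧-comm ⊚ ∧-mono ⊑-refl (≋⇒⊑ R-at) ⊚ p ⊚ ≋⇒⊒ ⇔-at) ⊚ ≋⇒⊒ (⋆-⟹ k)) ⊚ ≋⇒⊒ (⋆-∀ U)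
    where
      k = U ⊗₁ id
      R-at : k ⋆ (π₂ ⋆ R) ≋ R ⟦ π₁ ∘ π₂ , π₂ ∘ π₂ ⟧
      R-at = ⋆-∘ (π₂-β _ _ ⨾ identityˡ π₂ ⨾ ≡.sym (g-η π₂))
      ⇔-at : k ⋆ ((π₁ ∘ π₂ ∈ π₁) ⇔ (π₂ ∘ π₂ ∈ π₁)) ≋ (π₁ ∘ π₂ ∈ U ∘ π₁) ⇔ (π₂ ∘ π₂ ∈ U ∘ π₁)
      ⇔-at = ⋆-⇔ k ≋⨾ ⇔-cong (⋆-∈ k _ _ ≋⨾ ∈-≡ (∘π₂-⟨⟩ π₁ _ _ ⨾ cong (π₁ ∘_) (identityˡ π₂)) (π₁-β _ _))
                             (⋆-∈ k _ _ ≋⨾ ∈-≡ (∘π₂-⟨⟩ π₂ _ _ ⨾ cong (π₂ ∘_) (identityˡ π₂)) (π₁-β _ _))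

  ∈-subst : ∀ {Δ} (a b : Hom Δ A) (U : Hom Δ (𝒫 A)) → Eq A ⟦ a , b ⟧ ∧ a ∈ U ⊑ b ∈ U
  ∈-subst a b U =
    ∧-mono ⊑-refl (≋⇒⊒ (swapped a)) ⊚ Eq-subst (⟨ π₂ , π₁ ⟩ ⋆ [ ∈' A ]) U a b ⊚ ≋⇒⊑ (swapped b)
    where
      swapped : ∀ t → (⟨ π₂ , π₁ ⟩ ⋆ [ ∈' A ]) ⟦ U , t ⟧ ≋ t ∈ U
      swapped t = ⋆-∘ (swap-⟨⟩ U t)

  Eq⊑Agree : ∀ {Δ} (a b : Hom Δ A) (U : Hom Δ (𝒫 A)) → Eq A ⟦ a , b ⟧ ⊑ Agree U a b
  Eq⊑Agree a b U = ⟹-intro (∧-r ⊚ ∧-greatest (⟹-intro (∧-comm ⊚ ∈-subst a b U))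
                                            (⟹-intro (∧-comm ⊚ ∧-mono (Eq-sym a b) ⊑-refl ⊚ ∈-subst b a U)))

  R⊑Agree : ∀ {Δ} (a b : Hom Δ A) (U : Hom Δ (𝒫 A)) → R ⟦ a , b ⟧ ⊑ Agree U a b
  R⊑Agree a b U = ⟹-intro (modus-ponens (∧-l ⊚ Saturated-elim U a b) ∧-r)

  Agree-sym : ∀ {Δ} (a b : Hom Δ A) (U : Hom Δ (𝒫 A)) → Agree U a b ⊑ Agree U b a
  Agree-sym a b U = ⟹-mono ⊑-refl ⇔-sym

  Agree-trans : ∀ {Δ} (a b c : Hom Δ A) (U : Hom Δ (𝒫 A)) → Agree U a b ∧ Agree U b c ⊑ Agree U a c
  Agree-trans a b c U =
    ⟹-intro (∧-greatest (modus-ponens (∧-r ⊚ ∧-l) ∧-l) (modus-ponens (∧-r ⊚ ∧-r) ∧-l) ⊚ ⇔-trans)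

  ρ̄-isEquivalenceRel : IsEquivalenceRel A (un ρ̄)
  ρ̄-isEquivalenceRel = isEquivalenceRel-⟦⟧
    (λ t s → ρ̄-intro t s (≋⇒⊑ (⋆-⟦⟧ π₁ (Eq A) t s) ⊚ Eq⊑Agree _ _ π₂))
    (λ t s → ρ̄-intro s t (≋⇒⊑ (⋆-⟦⟧ π₁ ρ̄ t s) ⊚ ρ̄-elim _ _ π₂ ⊚ Agree-sym _ _ π₂))
    (λ a b c → ρ̄-intro a c (≋⇒⊑ (⋆-∧ π₁) ⊚ ∧-mono (≋⇒⊑ (⋆-⟦⟧ π₁ ρ̄ a b) ⊚ ρ̄-elim _ _ π₂)
                                                   (≋⇒⊑ (⋆-⟦⟧ π₁ ρ̄ b c) ⊚ ρ̄-elim _ _ π₂)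
                              ⊚ Agree-trans _ _ _ π₂))

  R⊑ρ̄ : R ⊑ ρ̄
  R⊑ρ̄ = ≋⇒⊑ (⟦π₁,π₂⟧ R) ⊚ ρ̄-intro π₁ π₂ (≋⇒⊑ (⋆-⟦⟧ π₁ R π₁ π₂) ⊚ R⊑Agree _ _ π₂) ⊚ ≋⇒⊒ (⟦π₁,π₂⟧ ρ̄)

  module Minimality {S : Fm (A ⊗ A)} (S-eq : IsEquivalenceRel A (un S)) (R⊑S : R ⊑ S) where
    open OnTerms S-eq

    class : Hom A (𝒫 A)
    class = proj₁ (weak-power {A} {A} (un S))

    ∈-class : ∀ {Δ} (t s : Hom Δ A) → t ∈ class ∘ s ≋ S ⟦ t , s ⟧
    ∈-class t s =
      ⋆-≡ (≡.sym (⟨⟩∘ _ _ _ ⨾ cong₂ ⟨_,_⟩ (∘π₁-⟨⟩ id t s ⨾ identityˡ t) (∘π₂-⟨⟩ class t s)))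
        ≋⨾ ≋-sym (⋆-∘ ≡.refl) ≋⨾ ⋆-cong ⟨ t , s ⟩ (proj₂ (weak-power {A} {A} (un S)))

    class-saturated : ⊤ ⊑ (class ∘ π₁) ⋆ Saturated
    class-saturated = Saturated-intro (class ∘ π₁) (∧-greatest (⟹-intro forward) (⟹-intro backward))
      where
        x y a : Hom ((A ⊗ A) ⊗ (A ⊗ A)) A
        x = π₁ ∘ π₂
        y = π₂ ∘ π₂
        a = π₁ ∘ π₁
        in-class : ∀ t → t ∈ (class ∘ π₁) ∘ π₁ ≋ S ⟦ t , a ⟧
        in-class t = ∈-≡ ≡.refl (assoc π₁ π₁ class) ≋⨾ ∈-class t a
        forward : x ∈ (class ∘ π₁) ∘ π₁ ∧ (π₁ ⋆ ⊤ ∧ R ⟦ x , y ⟧) ⊑ y ∈ (class ∘ π₁) ∘ π₁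
        forward =
          ∧-greatest (∧-r ⊚ ∧-r ⊚ ⋆-mono ⟨ x , y ⟩ R⊑S ⊚ sym-⟦⟧ x y) (∧-l ⊚ ≋⇒⊑ (in-class x))
            ⊚ trans-⟦⟧ y x a ⊚ ≋⇒⊒ (in-class y)
        backward : y ∈ (class ∘ π₁) ∘ π₁ ∧ (π₁ ⋆ ⊤ ∧ R ⟦ x , y ⟧) ⊑ x ∈ (class ∘ π₁) ∘ π₁
        backward = ∧-greatest (∧-r ⊚ ∧-r ⊚ ⋆-mono ⟨ x , y ⟩ R⊑S) (∧-l ⊚ ≋⇒⊑ (in-class y))
                     ⊚ trans-⟦⟧ x y a ⊚ ≋⇒⊒ (in-class x)

    Agree-class : Agree (class ∘ π₁) π₁ π₂ ⊑ S ⟦ π₂ , π₁ ⟧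
    Agree-class = modus-ponens (modus-ponens ⊑-refl (⊤-max ⊚ class-saturated) ⊚ ∧-l)
                               (⊤-max ⊚ refl-⟦⟧ π₁ ⊚ ≋⇒⊒ (∈-class π₁ π₁))
                  ⊚ ≋⇒⊑ (∈-class π₂ π₁)

    ρ̄⊑S : ρ̄ ⊑ S
    ρ̄⊑S =
      ≋⇒⊑ (⟦π₁,π₂⟧ ρ̄) ⊚ ρ̄-elim π₁ π₂ (class ∘ π₁) ⊚ Agree-class ⊚ sym-⟦⟧ π₂ π₁ ⊚ ≋⇒⊒ (⟦π₁,π₂⟧ S)

proposition8p5 : ∀ {o h c ℓ₁ ℓ₂ : Level} (C : CartesianCategory o h) (T : Tripos C c ℓ₁ ℓ₂)
    (A : CartesianCategory.Obj C) (ρ : Tripos.Fib T (CartesianCategory._⊗_ C A A)) →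
    Σ (Tripos.Fib T (CartesianCategory._⊗_ C A A)) λ ρ̄ →
      Tripos.IsEquivalenceRel T A ρ̄
      × Tripos.F._≤_ T (CartesianCategory._⊗_ C A A) ρ ρ̄
      × ((σ : Tripos.Fib T (CartesianCategory._⊗_ C A A)) → Tripos.IsEquivalenceRel T A σ →
          Tripos.F._≤_ T (CartesianCategory._⊗_ C A A) ρ σ →
          Tripos.F._≤_ T (CartesianCategory._⊗_ C A A) ρ̄ σ)
proposition8p5 C T A ρ =
  un ρ̄ , ρ̄-isEquivalenceRel , R⊑ρ̄ , λ σ σ-eq ρ⊑σ → Minimality.ρ̄⊑S σ-eq ρ⊑σ
  where
    open InternalLogic T using (un)
    open EquivalenceClosure T A ρ
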